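{- Let $d$ be a positive integer, let $S,T\subseteq\mathbb{N}^d$ be generalized numerical semigroups, $f:S\rightarrow T$ a monoid isomorphism and $\mathbf{x}\in\operatorname{SG}(S)$. Let $\mathbf{n}\in S\setminus\{\mathbf{0}\}$ and let $\mathbf{s}$ be a maximal element of $\operatorname{Ap}(S,\mathbf{n})$ with respect to $\leq_S$ such that $\mathbf{x}=\mathbf{s}-\mathbf{n}$, and set $\mathbf{y}=f(\mathbf{s})-f(\mathbf{n})$. Define $\overline{f}:S\cup\{\mathbf{x}\}\rightarrow T\cup\{\mathbf{y}\}$ by $\overline{f}(\mathbf{x})=\mathbf{y}$ and $\overline{f}(\mathbf{t})=f(\mathbf{t})$ for all $\mathbf{t}\in S$. Then $\overline{f}$ is an isomorphism of generalized numerical semigroups.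
   Context: A generalized numerical semigroup (GNS) in $\mathbb{N}^d$ is a submonoid $S$ of $(\mathbb{N}^d,+)$ with $\operatorname{H}(S)=\mathbb{N}^d\setminus S$ finite. For $L\subseteq\mathbb{N}^d$, $\mathbf{a}\leq_L\mathbf{b}$ means $\mathbf{b}-\mathbf{a}\in L$. $\operatorname{Ap}(S,\mathbf{n})=\{\mathbf{z}\in S\mid\mathbf{z}-\mathbf{n}\notin S\}$. $\operatorname{PF}(S)=\{\mathbf{h}\in\operatorname{H}(S)\mid\mathbf{h}+\mathbf{s}\in S\ \forall\mathbf{s}\in S\setminus\{\mathbf{0}\}\}$ and $\operatorname{SG}(S)=\{\mathbf{h}\in\operatorname{PF}(S)\mid 2\mathbf{h}\in S\}$; for $\mathbf{h}\in\operatorname{SG}(S)$, $S\cup\{\mathbf{h}\}$ is again a GNS. -}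

module Defs where

open import Level using (0ℓ)
open import Data.Nat using (ℕ; zero; suc; _+_)
import Data.Nat.Properties as ℕP
open import Data.Vec using (Vec; zipWith; replicate)
import Data.Vec.Properties as VP
open import Data.List using (List)
open import Data.List.Membership.Propositional using (_∈_)
open import Data.Product using (Σ; ∃; _×_; _,_)
open import Data.Sum using (_⊎_)
open import Relation.Nullary using (¬_; yes; no)
open import Relation.Unary using (Pred)
open import Relation.Binary.PropositionalEquality using (_≡_)

Pt : ℕ → Set
Pt d = Vec ℕ d

infixl 6 _⊕_
_⊕_ : ∀ {d} → Pt d → Pt d → Pt d
_⊕_ = zipWith _+_

𝟎 : ∀ {d} → Pt d
𝟎 {d} = replicate d 0

_≟ᵖ_ : ∀ {d} (a b : Pt d) → Relation.Nullary.Dec (a ≡ b)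
_≟ᵖ_ = VP.≡-dec ℕP._≟_

SubSet : ℕ → Set₁
SubSet d = Pred (Pt d) 0ℓ

_∪｛_｝ : ∀ {d} → SubSet d → Pt d → SubSet d
(S ∪｛ x ｝) p = S p ⊎ p ≡ x

record IsGNS {d : ℕ} (S : SubSet d) : Set where
  field
    zero∈ : S 𝟎
    closed : ∀ a b → S a → S b → S (a ⊕ b)
    finiteHoles : Σ (List (Pt d)) λ L → ∀ p → ¬ S p → p ∈ L

_≤[_]_ : ∀ {d} → Pt d → SubSet d → Pt d → Set
_≤[_]_ {d} a L b = Σ (Pt d) λ c → L c × a ⊕ c ≡ b

-- Apéry set: Ap(S,n) = { z ∈ S | z - n ∉ S }  (z - n ∈ S  iff  n ≤_S z)
Ap : ∀ {d} → SubSet d → Pt d → SubSet d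
Ap S n z = S z × ¬ (n ≤[ S ] z)

IsMaximal : ∀ {d} → SubSet d → SubSet d → Pt d → Set
IsMaximal S A s = A s × (∀ z → A z → s ≤[ S ] z → z ≡ s)

PF : ∀ {d} → SubSet d → SubSet d
PF S h = ¬ S h × (∀ s → S s → ¬ s ≡ 𝟎 → S (h ⊕ s))

SG : ∀ {d} → SubSet d → SubSet d
SG S h = PF S h × S (h ⊕ h)

-- f (a map on ℕ^d, only its restriction to S matters) is a monoid
-- isomorphism S → T
record IsMonoidIso {d : ℕ} (S T : SubSet d) (f : Pt d → Pt d) : Set where
  field
    maps : ∀ a → S a → T (f a)
    pres-𝟎 : f 𝟎 ≡ 𝟎
    pres-⊕ : ∀ a b → S a → S b → f (a ⊕ b) ≡ f a ⊕ f b
    injective : ∀ a b → S a → S b → f a ≡ f b → a ≡ b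
    surjective : ∀ b → T b → Σ (Pt d) λ a → S a × f a ≡ b

extend : ∀ {d} → (Pt d → Pt d) → Pt d → Pt d → Pt d → Pt d
extend f x y p with p ≟ᵖ x
... | yes _ = y
... | no _ = f p

{-# OPTIONS --safe #-}
module Submission where

-- Since 2x ∈ S, we have 2s = 2n + 2x in S, so 2 f(s) = 2 f(n) + f(2x) dominates
-- 2 f(n) componentwise; halving, f(n) ≤ f(s), and y = f(s) − f(n) ∈ ℕ^d.
-- For b ∈ S with x + b ∈ S, applying f to n + (x + b) = s + b and cancelling
-- f(n) gives f(x + b) = y + f(b); likewise f(2x) = 2y.  Finally y ∉ f(S),
-- because f(b) = y would give f(n + b) = f(s), i.e. n ≤_S s, contradicting
-- s ∈ Ap(S, n).  Closure of T ∪ {y} is then transported from S ∪ {x}.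

open import Defs
open import Level using (0ℓ)
open import Data.Nat using (ℕ; _≥_; _+_; _∸_; _≤_)
import Data.Nat.Properties as ℕ
open import Data.Vec using ([]; _∷_)
import Data.Vec.Properties as Vec
open import Data.Product using (Σ; _×_; _,_; proj₁; proj₂)
open import Data.Sum using (inj₁; inj₂)
open import Data.Empty using (⊥-elim)
open import Relation.Nullary using (¬_; yes; no)
open import Relation.Binary.PropositionalEquality
  using (_≡_; refl; sym; trans; cong; cong₂; subst; isEquivalence; module ≡-Reasoning)
open import Algebra.Bundles using (CommutativeMonoid)
open import Algebra.Structures using (IsCommutativeMonoid)
open import Algebra.Definitions using (LeftCancellative)

⊕-isCommutativeMonoid : ∀ {d} → IsCommutativeMonoid _≡_ (_⊕_ {d}) 𝟎
⊕-isCommutativeMonoid = record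
  { isMonoid = record
    { isSemigroup = record
      { isMagma = record { isEquivalence = isEquivalence ; ∙-cong = cong₂ _⊕_ }
      ; assoc = Vec.zipWith-assoc ℕ.+-assoc
      }
    ; identity = Vec.zipWith-identityˡ ℕ.+-identityˡ , Vec.zipWith-identityʳ ℕ.+-identityʳ
    }
  ; comm = Vec.zipWith-comm ℕ.+-comm
  }

⊕-commutativeMonoid : ℕ → CommutativeMonoid 0ℓ 0ℓ
⊕-commutativeMonoid d = record { isCommutativeMonoid = ⊕-isCommutativeMonoid {d} }

module _ {d : ℕ} where
  open CommutativeMonoid (⊕-commutativeMonoid d) public
    using () renaming (assoc to ⊕-assoc; comm to ⊕-comm; identityʳ to ⊕-identityʳ)
  open import Algebra.Properties.CommutativeSemigroup
    (CommutativeMonoid.commutativeSemigroup (⊕-commutativeMonoid d)) public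
    using () renaming (interchange to ⊕-interchange)

⊕-cancelˡ : ∀ {d} → LeftCancellative _≡_ (_⊕_ {d})
⊕-cancelˡ [] [] [] _ = refl
⊕-cancelˡ (a ∷ as) (b ∷ bs) (c ∷ cs) eq =
  cong₂ _∷_ (ℕ.+-cancelˡ-≡ a b c (Vec.∷-injectiveˡ eq))
            (⊕-cancelˡ as bs cs (Vec.∷-injectiveʳ eq))

infix 4 _≤ᵖ_
_≤ᵖ_ : ∀ {d} → Pt d → Pt d → Set
_≤ᵖ_ {d} a b = Σ (Pt d) λ c → a ⊕ c ≡ b

m+m≤n+n⇒m≤n : ∀ {m n} → m + m ≤ n + n → m ≤ n
m+m≤n+n⇒m≤n m+m≤n+n = ℕ.≮⇒≥ λ n<m → ℕ.<⇒≱ (ℕ.+-mono-< n<m n<m) m+m≤n+n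

≤ᵖ-halve : ∀ {d} {a b : Pt d} → a ⊕ a ≤ᵖ b ⊕ b → a ≤ᵖ b
≤ᵖ-halve {a = []} {[]} _ = [] , refl
≤ᵖ-halve {a = a ∷ as} {b ∷ bs} (c ∷ cs , eq) =
  let ds , as⊕ds≡bs = ≤ᵖ-halve (cs , Vec.∷-injectiveʳ eq)
      a+a≤b+b = subst (a + a ≤_) (Vec.∷-injectiveˡ eq) (ℕ.m≤m+n (a + a) c)
  in (b ∸ a) ∷ ds , cong₂ _∷_ (ℕ.m+[n∸m]≡n (m+m≤n+n⇒m≤n {a} a+a≤b+b)) as⊕ds≡bs

Closed : ∀ {d} → SubSet d → Set
Closed {d} S = ∀ (a b : Pt d) → S a → S b → S (a ⊕ b)

∪｛｝-IsGNS : ∀ {d} {S : SubSet d} {x : Pt d} →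
             IsGNS S → Closed (S ∪｛ x ｝) → IsGNS (S ∪｛ x ｝)
∪｛｝-IsGNS GS S∪x-closed = record
  { zero∈ = inj₁ (IsGNS.zero∈ GS)
  ; closed = S∪x-closed
  ; finiteHoles = let L , holes∈L = IsGNS.finiteHoles GS in
                  L , λ p p∉S∪x → holes∈L p (λ p∈S → p∉S∪x (inj₁ p∈S))
  }

x⊕-∈-∪｛SG｝ : ∀ {d} {S : SubSet d} {x : Pt d} → SG S x →
              ∀ b → S b → (S ∪｛ x ｝) (x ⊕ b)
x⊕-∈-∪｛SG｝ {x = x} ((_ , x⊕-∈S) , _) b b∈S with b ≟ᵖ 𝟎
... | yes refl = inj₂ (⊕-identityʳ x)
... | no b≢𝟎 = inj₁ (x⊕-∈S b b∈S b≢𝟎)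

∪｛SG｝-closed : ∀ {d} {S : SubSet d} {x : Pt d} →
               Closed S → SG S x → Closed (S ∪｛ x ｝)
∪｛SG｝-closed closed sg a b (inj₁ a∈S) (inj₁ b∈S) = inj₁ (closed a b a∈S b∈S)
∪｛SG｝-closed closed sg a b (inj₂ refl) (inj₁ b∈S) = x⊕-∈-∪｛SG｝ sg b b∈S
∪｛SG｝-closed {S = S} {x} closed sg a b (inj₁ a∈S) (inj₂ refl) =
  subst (S ∪｛ x ｝) (⊕-comm x a) (x⊕-∈-∪｛SG｝ sg a a∈S)
∪｛SG｝-closed closed (_ , 2x∈S) a b (inj₂ refl) (inj₂ refl) = inj₁ 2x∈S

closed-image : ∀ {d} {S T : SubSet d} {f : Pt d → Pt d} →
               IsMonoidIso S T f → Closed S → Closed T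
closed-image {T = T} F closed a b a∈T b∈T
  with IsMonoidIso.surjective F a a∈T | IsMonoidIso.surjective F b b∈T
... | a′ , a′∈S , refl | b′ , b′∈S , refl =
  subst T (pres-⊕ a′ b′ a′∈S b′∈S) (maps _ (closed a′ b′ a′∈S b′∈S))
  where open IsMonoidIso F

module _ {d : ℕ} (f : Pt d → Pt d) (x y : Pt d) where

  extend-≡ : extend f x y x ≡ y
  extend-≡ with x ≟ᵖ x
  ... | yes _ = refl
  ... | no x≢x = ⊥-elim (x≢x refl)

  extend-≢ : ∀ {p} → ¬ p ≡ x → extend f x y p ≡ f p
  extend-≢ {p} p≢x with p ≟ᵖ x
  ... | yes p≡x = ⊥-elim (p≢x p≡x)
  ... | no _ = refl

module Extension {d : ℕ} {S T : SubSet d} (GS : IsGNS S)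
  {f : Pt d → Pt d} (F : IsMonoidIso S T f) {x y : Pt d} (sg : SG S x)
  (y∉f[S] : ∀ b → S b → ¬ f b ≡ y)
  (f-x⊕ : ∀ b → S b → S (x ⊕ b) → f (x ⊕ b) ≡ y ⊕ f b)
  (f-x⊕x : f (x ⊕ x) ≡ y ⊕ y)
  where

  open IsGNS GS using (closed) renaming (zero∈ to 𝟎∈S)
  open IsMonoidIso F
  open ≡-Reasoning

  private
    g : Pt d → Pt d
    g = extend f x y

    x∉S : ¬ S x
    x∉S = proj₁ (proj₁ sg)

    x⊕-∈S : ∀ b → S b → ¬ b ≡ 𝟎 → S (x ⊕ b)
    x⊕-∈S = proj₂ (proj₁ sg)

    g-on-S : ∀ {p} → S p → g p ≡ f p
    g-on-S p∈S = extend-≢ f x y λ { refl → x∉S p∈S }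

    g-x : g x ≡ y
    g-x = extend-≡ f x y

    g-x⊕ : ∀ b → S b → g (x ⊕ b) ≡ g x ⊕ g b
    g-x⊕ b b∈S with b ≟ᵖ 𝟎
    ... | yes refl = begin
      g (x ⊕ 𝟎)  ≡⟨ cong g (⊕-identityʳ x) ⟩
      g x        ≡⟨ sym (⊕-identityʳ (g x)) ⟩
      g x ⊕ 𝟎    ≡⟨ cong (g x ⊕_) (sym (trans (g-on-S b∈S) pres-𝟎)) ⟩
      g x ⊕ g 𝟎  ∎
    ... | no b≢𝟎 = begin
      g (x ⊕ b)  ≡⟨ g-on-S (x⊕-∈S b b∈S b≢𝟎) ⟩
      f (x ⊕ b)  ≡⟨ f-x⊕ b b∈S (x⊕-∈S b b∈S b≢𝟎) ⟩
      y ⊕ f b    ≡⟨ cong₂ _⊕_ (sym g-x) (sym (g-on-S b∈S)) ⟩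
      g x ⊕ g b  ∎

    g-maps : ∀ a → (S ∪｛ x ｝) a → (T ∪｛ y ｝) (g a)
    g-maps a (inj₁ a∈S) = inj₁ (subst T (sym (g-on-S a∈S)) (maps a a∈S))
    g-maps a (inj₂ refl) = inj₂ g-x

    g-pres-⊕ : ∀ a b → (S ∪｛ x ｝) a → (S ∪｛ x ｝) b → g (a ⊕ b) ≡ g a ⊕ g b
    g-pres-⊕ a b (inj₁ a∈S) (inj₁ b∈S) = begin
      g (a ⊕ b)  ≡⟨ g-on-S (closed a b a∈S b∈S) ⟩
      f (a ⊕ b)  ≡⟨ pres-⊕ a b a∈S b∈S ⟩
      f a ⊕ f b  ≡⟨ cong₂ _⊕_ (sym (g-on-S a∈S)) (sym (g-on-S b∈S)) ⟩
      g a ⊕ g b  ∎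
    g-pres-⊕ a b (inj₂ refl) (inj₁ b∈S) = g-x⊕ b b∈S
    g-pres-⊕ a b (inj₁ a∈S) (inj₂ refl) = begin
      g (a ⊕ x)  ≡⟨ cong g (⊕-comm a x) ⟩
      g (x ⊕ a)  ≡⟨ g-x⊕ a a∈S ⟩
      g x ⊕ g a  ≡⟨ ⊕-comm (g x) (g a) ⟩
      g a ⊕ g x  ∎
    g-pres-⊕ a b (inj₂ refl) (inj₂ refl) = begin
      g (x ⊕ x)  ≡⟨ g-on-S (proj₂ sg) ⟩
      f (x ⊕ x)  ≡⟨ f-x⊕x ⟩
      y ⊕ y      ≡⟨ cong₂ _⊕_ (sym g-x) (sym g-x) ⟩
      g x ⊕ g x  ∎

    g-injective : ∀ a b → (S ∪｛ x ｝) a → (S ∪｛ x ｝) b → g a ≡ g b → a ≡ b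
    g-injective a b (inj₁ a∈S) (inj₁ b∈S) ga≡gb =
      injective a b a∈S b∈S (trans (sym (g-on-S a∈S)) (trans ga≡gb (g-on-S b∈S)))
    g-injective a b (inj₂ refl) (inj₁ b∈S) gx≡gb =
      ⊥-elim (y∉f[S] b b∈S (trans (sym (g-on-S b∈S)) (trans (sym gx≡gb) g-x)))
    g-injective a b (inj₁ a∈S) (inj₂ refl) ga≡gx =
      ⊥-elim (y∉f[S] a a∈S (trans (sym (g-on-S a∈S)) (trans ga≡gx g-x)))
    g-injective a b (inj₂ refl) (inj₂ refl) _ = refl

    g-surjective : ∀ b → (T ∪｛ y ｝) b → Σ (Pt d) λ a → (S ∪｛ x ｝) a × g a ≡ b
    g-surjective b (inj₁ b∈T) =
      let a , a∈S , fa≡b = surjective b b∈T in a , inj₁ a∈S , trans (g-on-S a∈S) fa≡b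
    g-surjective b (inj₂ refl) = x , inj₂ refl , g-x

  extend-IsMonoidIso : IsMonoidIso (S ∪｛ x ｝) (T ∪｛ y ｝) (extend f x y)
  extend-IsMonoidIso = record
    { maps = g-maps
    ; pres-𝟎 = trans (g-on-S 𝟎∈S) pres-𝟎
    ; pres-⊕ = g-pres-⊕
    ; injective = g-injective
    ; surjective = g-surjective
    }

module ImageOfSpecialGap {d : ℕ} {S T : SubSet d} (GS : IsGNS S)
  {f : Pt d → Pt d} (F : IsMonoidIso S T f) {x n s : Pt d} (sg : SG S x)
  (n∈S : S n) (s∈Ap : Ap S n s) (n⊕x≡s : n ⊕ x ≡ s)
  where

  open IsGNS GS using (closed)
  open IsMonoidIso F
  open ≡-Reasoning

  private
    s∈S : S s
    s∈S = proj₁ s∈Ap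

    2x∈S : S (x ⊕ x)
    2x∈S = proj₂ sg

  f-2s : f s ⊕ f s ≡ (f n ⊕ f n) ⊕ f (x ⊕ x)
  f-2s = begin
    f s ⊕ f s              ≡⟨ sym (pres-⊕ s s s∈S s∈S) ⟩
    f (s ⊕ s)              ≡⟨ cong (λ t → f (t ⊕ t)) (sym n⊕x≡s) ⟩
    f ((n ⊕ x) ⊕ (n ⊕ x))  ≡⟨ cong f (⊕-interchange n x n x) ⟩
    f ((n ⊕ n) ⊕ (x ⊕ x))  ≡⟨ pres-⊕ (n ⊕ n) (x ⊕ x) (closed n n n∈S n∈S) 2x∈S ⟩
    f (n ⊕ n) ⊕ f (x ⊕ x)  ≡⟨ cong (_⊕ f (x ⊕ x)) (pres-⊕ n n n∈S n∈S) ⟩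
    (f n ⊕ f n) ⊕ f (x ⊕ x) ∎

  fn≤fs : f n ≤ᵖ f s
  fn≤fs = ≤ᵖ-halve (f (x ⊕ x) , sym f-2s)

  y : Pt d
  y = proj₁ fn≤fs

  fn⊕y≡fs : f n ⊕ y ≡ f s
  fn⊕y≡fs = proj₂ fn≤fs

  f-x⊕ : ∀ b → S b → S (x ⊕ b) → f (x ⊕ b) ≡ y ⊕ f b
  f-x⊕ b b∈S x⊕b∈S = ⊕-cancelˡ (f n) _ _ (begin
    f n ⊕ f (x ⊕ b)  ≡⟨ sym (pres-⊕ n (x ⊕ b) n∈S x⊕b∈S) ⟩
    f (n ⊕ (x ⊕ b))  ≡⟨ cong f (sym (⊕-assoc n x b)) ⟩
    f ((n ⊕ x) ⊕ b)  ≡⟨ cong (λ t → f (t ⊕ b)) n⊕x≡s ⟩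
    f (s ⊕ b)        ≡⟨ pres-⊕ s b s∈S b∈S ⟩
    f s ⊕ f b        ≡⟨ cong (_⊕ f b) (sym fn⊕y≡fs) ⟩
    (f n ⊕ y) ⊕ f b  ≡⟨ ⊕-assoc (f n) y (f b) ⟩
    f n ⊕ (y ⊕ f b)  ∎)

  f-x⊕x : f (x ⊕ x) ≡ y ⊕ y
  f-x⊕x = ⊕-cancelˡ (f n ⊕ f n) _ _ (begin
    (f n ⊕ f n) ⊕ f (x ⊕ x)  ≡⟨ sym f-2s ⟩
    f s ⊕ f s                ≡⟨ cong₂ _⊕_ (sym fn⊕y≡fs) (sym fn⊕y≡fs) ⟩
    (f n ⊕ y) ⊕ (f n ⊕ y)    ≡⟨ ⊕-interchange (f n) y (f n) y ⟩
    (f n ⊕ f n) ⊕ (y ⊕ y)    ∎)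

  y∉f[S] : ∀ b → S b → ¬ f b ≡ y
  y∉f[S] b b∈S fb≡y = proj₂ s∈Ap (b , b∈S , injective (n ⊕ b) s n⊕b∈S s∈S (begin
    f (n ⊕ b)  ≡⟨ pres-⊕ n b n∈S b∈S ⟩
    f n ⊕ f b  ≡⟨ cong (f n ⊕_) fb≡y ⟩
    f n ⊕ y    ≡⟨ fn⊕y≡fs ⟩
    f s        ∎))
    where
    n⊕b∈S : S (n ⊕ b)
    n⊕b∈S = closed n b n∈S b∈S

mainTheorem17 : (d : ℕ) → d ≥ 1 → (S T : SubSet d) → IsGNS S → IsGNS T
    → (f : Pt d → Pt d) → IsMonoidIso S T f
    → (x : Pt d) → SG S x
    → (n : Pt d) → S n → ¬ n ≡ 𝟎
    → (s : Pt d) → IsMaximal S (Ap S n) s → n ⊕ x ≡ s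
    → Σ (Pt d) λ y → f n ⊕ y ≡ f s
        × IsGNS (S ∪｛ x ｝) × IsGNS (T ∪｛ y ｝)
        × IsMonoidIso (S ∪｛ x ｝) (T ∪｛ y ｝) (extend f x y)
mainTheorem17 _ _ S T GS GT f F x sg n n∈S _ s (s∈Ap , _) n⊕x≡s =
  y , fn⊕y≡fs , GS′ , GT′ , f̄-iso
  where
  open ImageOfSpecialGap GS F sg n∈S s∈Ap n⊕x≡s

  GS′ : IsGNS (S ∪｛ x ｝)
  GS′ = ∪｛｝-IsGNS GS (∪｛SG｝-closed (IsGNS.closed GS) sg)

  f̄-iso : IsMonoidIso (S ∪｛ x ｝) (T ∪｛ y ｝) (extend f x y)
  f̄-iso = Extension.extend-IsMonoidIso GS F sg y∉f[S] f-x⊕ f-x⊕x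

  GT′ : IsGNS (T ∪｛ y ｝)
  GT′ = ∪｛｝-IsGNS GT (closed-image f̄-iso (IsGNS.closed GS′))
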